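{- Let $q,\tilde q:\mathbb{Z}^n\to\mathbb{Z}$ be non-negative connected unit forms with $\tilde q$ of corank at most $1$. For an $n\times n$ integer matrix $B$, the following are equivalent: (a) $B$ is $\mathbb{Z}$-invertible and $\check G_{\tilde q}=B^{\mathrm{tr}}\check G_qB$; (b) $\tilde q(x)=q(Bx)$ for all $x\in\mathbb{Z}^n$, and $G_{\tilde q}B^*B=G_{\tilde q}$, where $B^*:=\check G_{\tilde q}^{ -1}B^{\mathrm{tr}}\check G_q$.
   Context: For a unit form $q:\mathbb{Z}^n\to\mathbb{Z}$ (integral quadratic form with $q(\mathbf{e}_i)=1$ for all $i$), $G_q$ is the symmetric Gram matrix of the polarization $q(x+y)-q(x)-q(y)$ and $\check G_q$ is the upper triangular integer matrix with $q(x)=x^{\mathrm{tr}}\check G_qx$ (so $G_q=\check G_q+\check G_q^{\mathrm{tr}}$ and $\check G_q$ has ones on the diagonal). The corank of $q$ is the rank of $\ker G_q$. Connected: the graph on $\{1,\dots,n\}$ with an edge $i$–$j$ whenever the coefficient of $x_ix_j$ ($i<j$) is nonzero is connected. -}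

module Defs where

open import Data.Nat using (ℕ; zero; suc)
open import Data.Fin using (Fin; zero; suc; _<_)
open import Data.Integer using (ℤ; _+_; _*_; _≤_; 0ℤ; 1ℤ; +_)
open import Data.Product using (Σ; _×_; ∃; ∃-syntax; _,_)
open import Data.Sum using (_⊎_)
open import Relation.Binary.PropositionalEquality using (_≡_; _≢_)
open import Relation.Nullary using (¬_)

Vecℤ : ℕ → Set
Vecℤ n = Fin n → ℤ

Mat : ℕ → Set
Mat n = Fin n → Fin n → ℤ

Σ[<] : ∀ n → (Fin n → ℤ) → ℤ
Σ[<] zero    f = 0ℤ
Σ[<] (suc n) f = f zero + Σ[<] n (λ i → f (suc i))

_ᵀ : ∀ {n} → Mat n → Mat n
(A ᵀ) i j = A j i

_⊗_ : ∀ {n} → Mat n → Mat n → Mat n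
_⊗_ {n} A B i j = Σ[<] n (λ k → A i k * B k j)

_⊕_ : ∀ {n} → Mat n → Mat n → Mat n
(A ⊕ B) i j = A i j + B i j

_·_ : ∀ {n} → Mat n → Vecℤ n → Vecℤ n
_·_ {n} A x i = Σ[<] n (λ k → A i k * x k)

I : ∀ {n} → Mat n
I i j with i Data.Fin.≟ j
... | Relation.Nullary.yes _ = 1ℤ
... | Relation.Nullary.no  _ = 0ℤ

_≋_ : ∀ {n} → Mat n → Mat n → Set
A ≋ B = ∀ i j → A i j ≡ B i j

Invertible : ∀ {n} → Mat n → Set
Invertible {n} B = ∃[ C ] ((B ⊗ C) ≋ I × (C ⊗ B) ≋ I)

IsInverse : ∀ {n} → Mat n → Mat n → Set
IsInverse A C = (A ⊗ C) ≋ I × (C ⊗ A) ≋ I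

-- A unit form q : ℤ^n → ℤ, given by its (unique) upper triangular matrix Ǧ_q
-- with ones on the diagonal:  q(x) = xᵀ Ǧ_q x.
record UnitForm (n : ℕ) : Set where
  field
    Ǧ     : Mat n
    diag  : ∀ i → Ǧ i i ≡ 1ℤ
    upper : ∀ i j → j < i → Ǧ i j ≡ 0ℤ
open UnitForm public

eval : ∀ {n} → UnitForm n → Vecℤ n → ℤ
eval {n} q x = Σ[<] n (λ i → Σ[<] n (λ j → x i * (Ǧ q i j * x j)))

G : ∀ {n} → UnitForm n → Mat n
G q = Ǧ q ⊕ (Ǧ q ᵀ)

NonNegative : ∀ {n} → UnitForm n → Set
NonNegative q = ∀ x → + 0 ≤ eval q x

-- Graph of q: edge i – j (i ≠ j) iff the coefficient of x_i x_j is nonzero.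
Edge : ∀ {n} → UnitForm n → Fin n → Fin n → Set
Edge q i j = (i < j × Ǧ q i j ≢ 0ℤ) ⊎ (j < i × Ǧ q j i ≢ 0ℤ)

data Reach {n} (q : UnitForm n) : Fin n → Fin n → Set where
  here : ∀ {i} → Reach q i i
  step : ∀ {i j k} → Edge q i j → Reach q j k → Reach q i k

Connected : ∀ {n} → UnitForm n → Set
Connected q = ∀ i j → Reach q i j

InKer : ∀ {n} → UnitForm n → Vecℤ n → Set
InKer q x = ∀ i → (G q · x) i ≡ 0ℤ

-- corank q ≤ 1: the free abelian group ker G_q has rank ≤ 1, i.e. any two
-- kernel vectors are ℤ-linearly dependent.
CorankAtMost1 : ∀ {n} → UnitForm n → Set
CorankAtMost1 q = ∀ x y → InKer q x → InKer q y →
  ∃[ a ] ∃[ b ] (¬ (a ≡ 0ℤ × b ≡ 0ℤ) × (∀ i → a * x i + b * y i ≡ 0ℤ))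

-- The forward direction is a computation: q(Bx) = xᵀ(BᵀǦ_q B)x, and B⋆B = Ǧ_q̃⁻¹BᵀǦ_q B = I.
--
-- Conversely, q̃(x) = q(Bx) says that Ǧ_q̃ and C = BᵀǦ_q B define the same quadratic form, so
-- D = C − Ǧ_q̃ is antisymmetric. The hypothesis G_q̃ B⋆B = G_q̃ puts the columns of
-- B⋆B − I = Ǧ_q̃⁻¹D into ker G_q̃, so by corank ≤ 1 any two of them are dependent, hence so
-- are any two columns of D. Reading a Dᵢ + b Dⱼ = 0 in rows i and j, where D has zero
-- diagonal and Dⱼᵢ = −Dᵢⱼ, gives a Dᵢⱼ = b Dᵢⱼ = 0, so D = 0. Thus C = Ǧ_q̃, and B⋆ is a left
-- inverse of B. It is also a right inverse: modulo any m, x ↦ Bx is injective on the finite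
-- set (ℤ/m)ⁿ, hence surjective, so BB⋆ ≡ I (mod m) for every m.

{-# OPTIONS --safe #-}
module Submission where

open import Defs
open import Data.Nat using (ℕ)
open import Data.Product using (_×_)
open import Relation.Binary.PropositionalEquality using (_≡_)
open import Function.Bundles using (_⇔_)

open import Data.Empty using (⊥-elim)
open import Data.Fin as Fin using (Fin; zero; suc; toℕ; _≟_; finToFun; funToFin; combine)
import Data.Fin.Properties as Finₚ
open import Data.Integer using (ℤ; _+_; _*_; _-_; -_; 0ℤ; -1ℤ; +_; ∣_∣)
import Data.Integer.Properties as ℤₚ
open import Data.Integer.DivMod using (_%ℕ_; _/ℕ_; n%ℕd<d; a≡a%ℕn+[a/ℕn]*n)
open import Data.Integer.Divisibility.Signed using (_∣_; divides; ∣m∣n⇒∣m+n; ∣m⇒∣-m; ∣n⇒∣m*n; ∣⇒∣ᵤ)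
open import Data.Integer.Tactic.RingSolver using (solve-∀)
import Data.Nat as ℕ
import Data.Nat.Properties as ℕₚ
import Data.Nat.Divisibility as ℕ∣
open import Data.Product using (∃-syntax; _,_; proj₁; proj₂)
open import Data.Sum using (inj₁; inj₂)
open import Function using (_∘_)
open import Function.Definitions using (Injective)
open import Function.Bundles using (mk⇔)
open import Relation.Binary.Bundles using (Setoid)
import Relation.Binary.Reasoning.Setoid
open import Relation.Binary.PropositionalEquality
  using (refl; sym; trans; cong; cong₂; subst; _≗_; module ≡-Reasoning)
open import Relation.Nullary using (¬_; yes; no)
open import Algebra.Properties.AbelianGroup ℤₚ.+-0-abelianGroup
  using () renaming (∙-cancelˡ to +-cancelˡ; ⁻¹-anti-homo‿- to neg-minus)
open import Algebra.Properties.CommutativeSemigroup ℤₚ.+-commutativeSemigroup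
  using () renaming (interchange to +-interchange)
open import Algebra.Properties.CommutativeSemigroup ℤₚ.*-commutativeSemigroup
  using () renaming (x∙yz≈y∙xz to *-left-swap)

-- Finite sums and matrices

Σ-cong : ∀ n {f g : Fin n → ℤ} → f ≗ g → Σ[<] n f ≡ Σ[<] n g
Σ-cong ℕ.zero    f≗g = refl
Σ-cong (ℕ.suc n) f≗g = cong₂ _+_ (f≗g zero) (Σ-cong n (f≗g ∘ suc))

Σ-zero : ∀ n → Σ[<] n (λ _ → 0ℤ) ≡ 0ℤ
Σ-zero ℕ.zero    = refl
Σ-zero (ℕ.suc n) = cong (_+_ 0ℤ) (Σ-zero n)

Σ-distrib-+ : ∀ n (f g : Fin n → ℤ) → Σ[<] n (λ i → f i + g i) ≡ Σ[<] n f + Σ[<] n g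
Σ-distrib-+ ℕ.zero    f g = refl
Σ-distrib-+ (ℕ.suc n) f g =
  trans (cong (_+_ (f zero + g zero)) (Σ-distrib-+ n (f ∘ suc) (g ∘ suc)))
        (+-interchange (f zero) (g zero) _ _)

*-distribˡ-Σ : ∀ n c (f : Fin n → ℤ) → c * Σ[<] n f ≡ Σ[<] n (λ i → c * f i)
*-distribˡ-Σ ℕ.zero    c f = ℤₚ.*-zeroʳ c
*-distribˡ-Σ (ℕ.suc n) c f =
  trans (ℤₚ.*-distribˡ-+ c (f zero) _) (cong (_+_ (c * f zero)) (*-distribˡ-Σ n c (f ∘ suc)))

*-distribʳ-Σ : ∀ n c (f : Fin n → ℤ) → Σ[<] n f * c ≡ Σ[<] n (λ i → f i * c)
*-distribʳ-Σ n c f =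
  trans (ℤₚ.*-comm _ c) (trans (*-distribˡ-Σ n c f) (Σ-cong n (λ i → ℤₚ.*-comm c (f i))))

Σ-comm : ∀ m n (f : Fin m → Fin n → ℤ) →
         Σ[<] m (λ i → Σ[<] n (f i)) ≡ Σ[<] n (λ j → Σ[<] m (λ i → f i j))
Σ-comm ℕ.zero    n f = sym (Σ-zero n)
Σ-comm (ℕ.suc m) n f =
  trans (cong (_+_ (Σ[<] n (f zero))) (Σ-comm m n (f ∘ suc))) (sym (Σ-distrib-+ n (f zero) _))

I-suc : ∀ {n} (i j : Fin n) → I (suc i) (suc j) ≡ I i j
I-suc i j with i ≟ j
... | yes refl = refl
... | no _     = refl

I-sym : ∀ {n} (i j : Fin n) → I i j ≡ I j i
I-sym i j with i ≟ j | j ≟ i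
... | yes refl | yes _    = refl
... | yes refl | no j≢i   = ⊥-elim (j≢i refl)
... | no i≢j   | yes refl = ⊥-elim (i≢j refl)
... | no _     | no _     = refl

Σ-δ : ∀ n (i : Fin n) (f : Fin n → ℤ) → Σ[<] n (λ k → I i k * f k) ≡ f i
Σ-δ (ℕ.suc n) zero f =
  trans (cong₂ _+_ (ℤₚ.*-identityˡ (f zero))
                   (trans (Σ-cong n (λ k → ℤₚ.*-zeroˡ (f (suc k)))) (Σ-zero n)))
        (ℤₚ.+-identityʳ (f zero))
Σ-δ (ℕ.suc n) (suc i) f =
  trans (cong₂ _+_ (ℤₚ.*-zeroˡ (f zero))
                   (trans (Σ-cong n (λ k → cong (_* f (suc k)) (I-suc i k))) (Σ-δ n i (f ∘ suc))))
        (ℤₚ.+-identityˡ (f (suc i)))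

Σ-δʳ : ∀ n (j : Fin n) (f : Fin n → ℤ) → Σ[<] n (λ k → f k * I k j) ≡ f j
Σ-δʳ n j f = trans (Σ-cong n (λ k → trans (ℤₚ.*-comm (f k) _) (cong (_* f k) (I-sym k j)))) (Σ-δ n j f)

-- (A ⊗ B) i j unfolds to (A · col B j) i, so matrix facts reduce to facts about A · x.
col : ∀ {n} → Mat n → Fin n → Vecℤ n
col A j k = A k j

e : ∀ {n} → Fin n → Vecℤ n
e = col I

_⊖_ : ∀ {n} → Mat n → Mat n → Mat n
(A ⊖ B) i j = A i j - B i j

≋-setoid : ℕ → Setoid _ _
≋-setoid n = record
  { Carrier       = Mat n
  ; _≈_           = _≋_
  ; isEquivalence = record
    { refl  = λ i j → refl
    ; sym   = λ A≋B i j → sym (A≋B i j)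
    ; trans = λ A≋B B≋C i j → trans (A≋B i j) (B≋C i j)
    }
  }

module ≋-Reasoning (n : ℕ) = Relation.Binary.Reasoning.Setoid (≋-setoid n)

·-cong : ∀ {n} (A : Mat n) {x y : Vecℤ n} → x ≗ y → A · x ≗ A · y
·-cong {n} A x≗y i = Σ-cong n (λ k → cong (A i k *_) (x≗y k))

·-congˡ : ∀ {n} {A A' : Mat n} → A ≋ A' → ∀ x → A · x ≗ A' · x
·-congˡ {n} A≋A' x i = Σ-cong n (λ k → cong (_* x k) (A≋A' i k))

⊗-congˡ : ∀ {n} {A A' : Mat n} → A ≋ A' → ∀ B → (A ⊗ B) ≋ (A' ⊗ B)
⊗-congˡ A≋A' B i j = ·-congˡ A≋A' (col B j) i

⊗-congʳ : ∀ {n} (A : Mat n) {B B' : Mat n} → B ≋ B' → (A ⊗ B) ≋ (A ⊗ B')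
⊗-congʳ A B≋B' i j = ·-cong A (λ k → B≋B' k j) i

·-assoc : ∀ {n} (A B : Mat n) (x : Vecℤ n) → A · (B · x) ≗ (A ⊗ B) · x
·-assoc {n} A B x i = begin
  Σ[<] n (λ k → A i k * Σ[<] n (λ l → B k l * x l))   ≡⟨ Σ-cong n (λ k → *-distribˡ-Σ n (A i k) _) ⟩
  Σ[<] n (λ k → Σ[<] n (λ l → A i k * (B k l * x l)))  ≡⟨ Σ-comm n n _ ⟩
  Σ[<] n (λ l → Σ[<] n (λ k → A i k * (B k l * x l)))  ≡⟨ Σ-cong n (λ l → Σ-cong n (λ k → sym (ℤₚ.*-assoc (A i k) (B k l) (x l)))) ⟩
  Σ[<] n (λ l → Σ[<] n (λ k → A i k * B k l * x l))    ≡⟨ Σ-cong n (λ l → sym (*-distribʳ-Σ n (x l) _)) ⟩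
  Σ[<] n (λ l → Σ[<] n (λ k → A i k * B k l) * x l)    ∎
  where open ≡-Reasoning

⊗-assoc : ∀ {n} (A B C : Mat n) → ((A ⊗ B) ⊗ C) ≋ (A ⊗ (B ⊗ C))
⊗-assoc A B C i j = sym (·-assoc A B (col C j) i)

·-identityˡ : ∀ {n} (x : Vecℤ n) → I · x ≗ x
·-identityˡ {n} x i = Σ-δ n i x

⊗-identityˡ : ∀ {n} (A : Mat n) → (I ⊗ A) ≋ A
⊗-identityˡ A i j = ·-identityˡ (col A j) i

⊗-identityʳ : ∀ {n} (A : Mat n) → (A ⊗ I) ≋ A
⊗-identityʳ {n} A i j = Σ-δʳ n j (A i)

·-distrib-+ : ∀ {n} (A : Mat n) (x y : Vecℤ n) → A · (λ k → x k + y k) ≗ λ i → (A · x) i + (A · y) i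
·-distrib-+ {n} A x y i =
  trans (Σ-cong n (λ k → ℤₚ.*-distribˡ-+ (A i k) (x k) (y k))) (Σ-distrib-+ n _ _)

·-scale : ∀ {n} (A : Mat n) c (x : Vecℤ n) → A · (λ k → c * x k) ≗ λ i → c * (A · x) i
·-scale {n} A c x i =
  trans (Σ-cong n (λ k → *-left-swap (A i k) c (x k))) (sym (*-distribˡ-Σ n c _))

·-distrib-minus : ∀ {n} (A : Mat n) (x y : Vecℤ n) → A · (λ k → x k - y k) ≗ λ i → (A · x) i - (A · y) i
·-distrib-minus A x y i = trans (·-distrib-+ A x (-_ ∘ y) i) (cong (_+_ ((A · x) i)) A·-y)
  where
  A·-y : (A · (-_ ∘ y)) i ≡ - (A · y) i
  A·-y = trans (·-cong A (λ k → sym (ℤₚ.-1*i≡-i (y k))) i)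
               (trans (·-scale A -1ℤ y i) (ℤₚ.-1*i≡-i _))

⊗-distribˡ-⊖ : ∀ {n} (A X Y : Mat n) → (A ⊗ (X ⊖ Y)) ≋ ((A ⊗ X) ⊖ (A ⊗ Y))
⊗-distribˡ-⊖ A X Y i j = ·-distrib-minus A (col X j) (col Y j) i

-- Quadratic forms

dot : ∀ {n} → Vecℤ n → Vecℤ n → ℤ
dot {n} x y = Σ[<] n (λ i → x i * y i)

quadForm : ∀ {n} → Mat n → Vecℤ n → ℤ
quadForm A x = dot x (A · x)

eval≡quadForm : ∀ {n} (q : UnitForm n) x → eval q x ≡ quadForm (Ǧ q) x
eval≡quadForm {n} q x = Σ-cong n (λ i → sym (*-distribˡ-Σ n (x i) _))

dot-congʳ : ∀ {n} (x : Vecℤ n) {y y' : Vecℤ n} → y ≗ y' → dot x y ≡ dot x y'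
dot-congʳ {n} x y≗y' = Σ-cong n (λ i → cong (x i *_) (y≗y' i))

dot-distribˡ-+ : ∀ {n} (x y z : Vecℤ n) → dot (λ k → x k + y k) z ≡ dot x z + dot y z
dot-distribˡ-+ {n} x y z = trans (Σ-cong n (λ k → ℤₚ.*-distribʳ-+ (z k) (x k) (y k))) (Σ-distrib-+ n _ _)

dot-e : ∀ {n} (i : Fin n) (v : Vecℤ n) → dot (e i) v ≡ v i
dot-e {n} i v = trans (Σ-cong n (λ k → cong (_* v k) (I-sym k i))) (Σ-δ n i v)

dot-ᵀ : ∀ {n} (B : Mat n) (x y : Vecℤ n) → dot x ((B ᵀ) · y) ≡ dot (B · x) y
dot-ᵀ {n} B x y = begin
  Σ[<] n (λ i → x i * Σ[<] n (λ k → B k i * y k))   ≡⟨ Σ-cong n (λ i → *-distribˡ-Σ n (x i) _) ⟩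
  Σ[<] n (λ i → Σ[<] n (λ k → x i * (B k i * y k)))  ≡⟨ Σ-comm n n _ ⟩
  Σ[<] n (λ k → Σ[<] n (λ i → x i * (B k i * y k)))  ≡⟨ Σ-cong n (λ k → Σ-cong n (λ i → reorder (x i) (B k i) (y k))) ⟩
  Σ[<] n (λ k → Σ[<] n (λ i → B k i * x i * y k))    ≡⟨ Σ-cong n (λ k → sym (*-distribʳ-Σ n (y k) _)) ⟩
  Σ[<] n (λ k → Σ[<] n (λ i → B k i * x i) * y k)    ∎
  where
  open ≡-Reasoning
  reorder : ∀ a b c → a * (b * c) ≡ b * a * c
  reorder a b c = trans (*-left-swap a b c) (sym (ℤₚ.*-assoc b a c))

quadForm-ᵀ⊗⊗ : ∀ {n} (A B : Mat n) (x : Vecℤ n) → quadForm ((B ᵀ) ⊗ (A ⊗ B)) x ≡ quadForm A (B · x)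
quadForm-ᵀ⊗⊗ A B x = begin
  dot x (((B ᵀ) ⊗ (A ⊗ B)) · x)   ≡⟨ dot-congʳ x (λ i → sym (·-assoc (B ᵀ) (A ⊗ B) x i)) ⟩
  dot x ((B ᵀ) · ((A ⊗ B) · x))   ≡⟨ dot-ᵀ B x _ ⟩
  dot (B · x) ((A ⊗ B) · x)       ≡⟨ dot-congʳ (B · x) (λ i → sym (·-assoc A B x i)) ⟩
  dot (B · x) (A · (B · x))       ∎
  where open ≡-Reasoning

quadForm-e : ∀ {n} (A : Mat n) i → quadForm A (e i) ≡ A i i
quadForm-e A i = trans (dot-e i (A · e i)) (⊗-identityʳ A i i)

quadForm-e+e : ∀ {n} (A : Mat n) i j →
               quadForm A (λ k → e i k + e j k) ≡ (A i i + A j j) + (A i j + A j i)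
quadForm-e+e {n} A i j = begin
  dot (λ k → e i k + e j k) w              ≡⟨ dot-distribˡ-+ (e i) (e j) w ⟩
  dot (e i) w + dot (e j) w                ≡⟨ cong₂ _+_ (dot-e i w) (dot-e j w) ⟩
  w i + w j                                ≡⟨ cong₂ _+_ (w≡ i) (w≡ j) ⟩
  (A i i + A i j) + (A j i + A j j)        ≡⟨ regroup (A i i) (A i j) (A j i) (A j j) ⟩
  (A i i + A j j) + (A i j + A j i)        ∎
  where
  open ≡-Reasoning
  w : Vecℤ n
  w = A · (λ k → e i k + e j k)
  w≡ : ∀ k → w k ≡ A k i + A k j
  w≡ k = trans (·-distrib-+ A (e i) (e j) k) (cong₂ _+_ (⊗-identityʳ A k i) (⊗-identityʳ A k j))
  regroup : ∀ a b c d → (a + b) + (c + d) ≡ (a + d) + (b + c)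
  regroup = solve-∀

quadForm-≗⇒symmetrisation-≡ : ∀ {n} (A A' : Mat n) → (∀ x → quadForm A x ≡ quadForm A' x) →
                              ∀ i j → A i j + A j i ≡ A' i j + A' j i
quadForm-≗⇒symmetrisation-≡ A A' QA≗QA' i j = +-cancelˡ (A' i i + A' j j) _ _ (begin
  (A' i i + A' j j) + (A i j + A j i)   ≡⟨ cong₂ (λ a b → (a + b) + (A i j + A j i)) (diagonal-≡ i) (diagonal-≡ j) ⟨
  (A i i + A j j) + (A i j + A j i)     ≡⟨ quadForm-e+e A i j ⟨
  quadForm A (λ k → e i k + e j k)      ≡⟨ QA≗QA' (λ k → e i k + e j k) ⟩
  quadForm A' (λ k → e i k + e j k)     ≡⟨ quadForm-e+e A' i j ⟩
  (A' i i + A' j j) + (A' i j + A' j i) ∎)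
  where
  open ≡-Reasoning
  diagonal-≡ : ∀ k → A k k ≡ A' k k
  diagonal-≡ k = trans (sym (quadForm-e A k)) (trans (QA≗QA' (e k)) (quadForm-e A' k))

-- Linear dependence

LinearlyDependent : ∀ {n} → Vecℤ n → Vecℤ n → Set
LinearlyDependent x y = ∃[ a ] ∃[ b ] (¬ (a ≡ 0ℤ × b ≡ 0ℤ) × (∀ i → a * x i + b * y i ≡ 0ℤ))

·-preserves-LinearlyDependent : ∀ {n} (A : Mat n) {x y : Vecℤ n} →
                                LinearlyDependent x y → LinearlyDependent (A · x) (A · y)
·-preserves-LinearlyDependent {n} A {x} {y} (a , b , nontrivial , ax+by≡0) = a , b , nontrivial , λ i → begin
  a * (A · x) i + b * (A · y) i                     ≡⟨ cong₂ _+_ (·-scale A a x i) (·-scale A b y i) ⟨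
  (A · (λ k → a * x k)) i + (A · (λ k → b * y k)) i ≡⟨ ·-distrib-+ A _ _ i ⟨
  (A · (λ k → a * x k + b * y k)) i                 ≡⟨ ·-cong A ax+by≡0 i ⟩
  (A · (λ _ → 0ℤ)) i                                ≡⟨ Σ-cong n (λ k → ℤₚ.*-zeroʳ (A i k)) ⟩
  Σ[<] n (λ _ → 0ℤ)                                 ≡⟨ Σ-zero n ⟩
  0ℤ                                                ∎
  where open ≡-Reasoning

a*d≡0∧b*d≡0⇒d≡0 : ∀ {a b d} → ¬ (a ≡ 0ℤ × b ≡ 0ℤ) → a * d ≡ 0ℤ → b * d ≡ 0ℤ → d ≡ 0ℤ
a*d≡0∧b*d≡0⇒d≡0 {a} {b} nontrivial ad≡0 bd≡0 with ℤₚ.i*j≡0⇒i≡0∨j≡0 a ad≡0 | ℤₚ.i*j≡0⇒i≡0∨j≡0 b bd≡0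
... | inj₂ d≡0 | _        = d≡0
... | inj₁ _   | inj₂ d≡0 = d≡0
... | inj₁ a≡0 | inj₁ b≡0 = ⊥-elim (nontrivial (a≡0 , b≡0))

x+x≡0⇒x≡0 : ∀ {x} → x + x ≡ 0ℤ → x ≡ 0ℤ
x+x≡0⇒x≡0 {x} x+x≡0 = ℤₚ.*-cancelˡ-≡ (+ 2) x 0ℤ (trans (sym (double x)) x+x≡0)
  where
  double : ∀ x → x + x ≡ + 2 * x
  double = solve-∀

antisymmetric∧dependentColumns⇒≋0 : ∀ {n} (D : Mat n) → (∀ i j → D i j + D j i ≡ 0ℤ) →
                                    (∀ i j → LinearlyDependent (col D i) (col D j)) →
                                    ∀ i j → D i j ≡ 0ℤ
antisymmetric∧dependentColumns⇒≋0 D anti dependent i j with dependent i j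
... | a , b , nontrivial , aDᵢ+bDⱼ≡0 = a*d≡0∧b*d≡0⇒d≡0 nontrivial aDij≡0 bDij≡0
  where
  open ≡-Reasoning
  *-diagonal≡0 : ∀ c k → c * D k k ≡ 0ℤ
  *-diagonal≡0 c k = trans (cong (c *_) (x+x≡0⇒x≡0 (anti k k))) (ℤₚ.*-zeroʳ c)

  bDij≡0 : b * D i j ≡ 0ℤ
  bDij≡0 = begin
    b * D i j              ≡⟨ ℤₚ.+-identityˡ (b * D i j) ⟨
    0ℤ + b * D i j         ≡⟨ cong (_+ b * D i j) (*-diagonal≡0 a i) ⟨
    a * D i i + b * D i j  ≡⟨ aDᵢ+bDⱼ≡0 i ⟩
    0ℤ                     ∎

  aDji≡0 : a * D j i ≡ 0ℤ
  aDji≡0 = begin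
    a * D j i              ≡⟨ ℤₚ.+-identityʳ (a * D j i) ⟨
    a * D j i + 0ℤ         ≡⟨ cong (_+_ (a * D j i)) (*-diagonal≡0 b j) ⟨
    a * D j i + b * D j j  ≡⟨ aDᵢ+bDⱼ≡0 j ⟩
    0ℤ                     ∎

  aDij≡0 : a * D i j ≡ 0ℤ
  aDij≡0 = begin
    a * D i j              ≡⟨ ℤₚ.+-identityʳ (a * D i j) ⟨
    a * D i j + 0ℤ         ≡⟨ cong (_+_ (a * D i j)) aDji≡0 ⟨
    a * D i j + a * D j i  ≡⟨ ℤₚ.*-distribˡ-+ a (D i j) (D j i) ⟨
    a * (D i j + D j i)    ≡⟨ cong (a *_) (anti i j) ⟩
    a * 0ℤ                 ≡⟨ ℤₚ.*-zeroʳ a ⟩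
    0ℤ                     ∎

-- Integer matrices with a left inverse

[a-b]+[c-d]≡[a+c]-[b+d] : ∀ a b c d → (a - b) + (c - d) ≡ (a + c) - (b + d)
[a-b]+[c-d]≡[a+c]-[b+d] = solve-∀

infix 4 _≡_mod_

-- A record rather than a synonym for + m ∣ a - b, so that a and b stay inferable.
record _≡_mod_ (a b : ℤ) (m : ℕ) : Set where
  constructor ≡-mod
  field divides-difference : + m ∣ a - b

≡-mod-setoid : ℕ → Setoid _ _
≡-mod-setoid m = record
  { Carrier       = ℤ
  ; _≈_           = (λ a b → a ≡ b mod m)
  ; isEquivalence = record
    { refl  = λ {a} → ≡-mod (divides 0ℤ (trans (ℤₚ.+-inverseʳ a) (sym (ℤₚ.*-zeroˡ (+ m)))))
    ; sym   = λ {a} {b} (≡-mod a≡b) → ≡-mod (subst (+ m ∣_) (neg-minus a b) (∣m⇒∣-m a≡b))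
    ; trans = λ {a} {b} {c} (≡-mod a≡b) (≡-mod b≡c) →
                ≡-mod (subst (+ m ∣_) (ℤₚ.+-minus-telescope a b c) (∣m∣n⇒∣m+n a≡b b≡c))
    }
  }

module ≡-mod-Reasoning (m : ℕ) = Relation.Binary.Reasoning.Setoid (≡-mod-setoid m)

≡⇒≡-mod : ∀ {m a b} → a ≡ b → a ≡ b mod m
≡⇒≡-mod {m} refl = Setoid.refl (≡-mod-setoid m)

+-cong-mod : ∀ {m a b c d} → a ≡ b mod m → c ≡ d mod m → a + c ≡ b + d mod m
+-cong-mod {m} {a} {b} {c} {d} (≡-mod a≡b) (≡-mod c≡d) =
  ≡-mod (subst (+ m ∣_) ([a-b]+[c-d]≡[a+c]-[b+d] a b c d) (∣m∣n⇒∣m+n a≡b c≡d))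

*-congˡ-mod : ∀ {m a b} c → a ≡ b mod m → c * a ≡ c * b mod m
*-congˡ-mod {m} {a} {b} c (≡-mod a≡b) = ≡-mod (subst (+ m ∣_) (factor c a b) (∣n⇒∣m*n c a≡b))
  where
  factor : ∀ c a b → c * (a - b) ≡ c * a - c * b
  factor = solve-∀

Σ-cong-mod : ∀ {m} n {f g : Fin n → ℤ} → (∀ i → f i ≡ g i mod m) → Σ[<] n f ≡ Σ[<] n g mod m
Σ-cong-mod ℕ.zero    f≡g = ≡⇒≡-mod refl
Σ-cong-mod (ℕ.suc n) f≡g = +-cong-mod (f≡g zero) (Σ-cong-mod n (f≡g ∘ suc))

·-cong-mod : ∀ {m n} (A : Mat n) {x y : Vecℤ n} → (∀ k → x k ≡ y k mod m) →
              ∀ i → (A · x) i ≡ (A · y) i mod m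
·-cong-mod {n = n} A x≡y i = Σ-cong-mod n (λ k → *-congˡ-mod (A i k) (x≡y k))

≡-mod⇒≡ : ∀ {m a b} → ∣ a - b ∣ ℕ.< m → a ≡ b mod m → a ≡ b
≡-mod⇒≡ {m} {a} {b} small (≡-mod a≡b) with ∣ a - b ∣ in ∣a-b∣≡
... | ℕ.zero  = ℤₚ.i-j≡0⇒i≡j a b (ℤₚ.∣i∣≡0⇒i≡0 ∣a-b∣≡)
... | ℕ.suc _ = ⊥-elim (ℕ∣.>⇒∤ small (subst (m ℕ∣.∣_) ∣a-b∣≡ (∣⇒∣ᵤ a≡b)))

toℕ-≡-mod⇒≡ : ∀ {m} (u v : Fin m) → + toℕ u ≡ + toℕ v mod m → u ≡ v
toℕ-≡-mod⇒≡ u v u≡v = Finₚ.toℕ-injective (ℤₚ.+-injective (≡-mod⇒≡ small u≡v))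
  where
  small : ∣ + toℕ u - + toℕ v ∣ ℕ.< _
  small = ℕₚ.≤-<-trans
    (subst (ℕ._≤ toℕ u ℕ.⊔ toℕ v) (cong ∣_∣ (sym (ℤₚ.[+m]-[+n]≡m⊖n (toℕ u) (toℕ v))))
           (ℤₚ.∣m⊝n∣≤m⊔n (toℕ u) (toℕ v)))
    (ℕₚ.⊔-lub (Finₚ.toℕ<n u) (Finₚ.toℕ<n v))

residue : ∀ m .{{_ : ℕ.NonZero m}} → ℤ → Fin m
residue m a = Fin.fromℕ< (n%ℕd<d a m)

≡-mod-residue : ∀ m .{{_ : ℕ.NonZero m}} a → a ≡ + toℕ (residue m a) mod m
≡-mod-residue m a = ≡-mod (divides (a /ℕ m) (begin
  a - + toℕ (residue m a)               ≡⟨ cong (λ r → a - + r) (Finₚ.toℕ-fromℕ< (n%ℕd<d a m)) ⟩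
  a - + (a %ℕ m)                        ≡⟨ cong (_- + (a %ℕ m)) (a≡a%ℕn+[a/ℕn]*n a m) ⟩
  + (a %ℕ m) + a /ℕ m * + m - + (a %ℕ m) ≡⟨ cancel (+ (a %ℕ m)) (a /ℕ m * + m) ⟩
  a /ℕ m * + m                          ∎))
  where
  open ≡-Reasoning
  cancel : ∀ r s → r + s - r ≡ s
  cancel = solve-∀

residue-≡⇒≡-mod : ∀ m .{{_ : ℕ.NonZero m}} {a b} → residue m a ≡ residue m b → a ≡ b mod m
residue-≡⇒≡-mod m {a} {b} ra≡rb = begin
  a                       ≈⟨ ≡-mod-residue m a ⟩
  + toℕ (residue m a)     ≡⟨ cong (+_ ∘ toℕ) ra≡rb ⟩
  + toℕ (residue m b)     ≈⟨ ≡-mod-residue m b ⟨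
  b                       ∎
  where open ≡-mod-Reasoning m

Fin-injective⇒surjective : ∀ {k} (h : Fin k → Fin k) → Injective _≡_ _≡_ h → ∀ y → ∃[ x ] h x ≡ y
Fin-injective⇒surjective {ℕ.suc k} h h-injective y with Finₚ.any? (λ x → h x ≟ y)
... | yes hit = hit
... | no ¬hit =
  let a , b , a<b , pa≡pb = Finₚ.pigeonhole (ℕₚ.n<1+n k) (λ x → Fin.punchOut (y≢h x))
  in ⊥-elim (Finₚ.<-irrefl (h-injective (Finₚ.punchOut-injective (y≢h a) (y≢h b) pa≡pb)) a<b)
  where
  y≢h : ∀ x → ¬ (y ≡ h x)
  y≢h x y≡hx = ¬hit (x , sym y≡hx)

funToFin-cong : ∀ {m n} {f g : Fin m → Fin n} → f ≗ g → funToFin f ≡ funToFin g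
funToFin-cong {ℕ.zero}  _   = refl
funToFin-cong {ℕ.suc m} f≗g = cong₂ combine (f≗g zero) (funToFin-cong (f≗g ∘ suc))

→-injective⇒surjective : ∀ {m n} (f : (Fin n → Fin m) → (Fin n → Fin m)) →
                         (∀ {v w} → f v ≗ f w → v ≗ w) → ∀ t → ∃[ v ] f v ≗ t
→-injective⇒surjective {m} {n} f f-injective t = finToFun c , fc≗t
  where
  open ≡-Reasoning
  h : Fin (m ℕ.^ n) → Fin (m ℕ.^ n)
  h = funToFin ∘ f ∘ finToFun {m} {n}

  h-injective : Injective _≡_ _≡_ h
  h-injective {a} {b} ha≡hb = begin
    a                              ≡⟨ Finₚ.funToFin-finToFin {n} {m} a ⟨
    funToFin (finToFun {m} {n} a)  ≡⟨ funToFin-cong (f-injective fa≗fb) ⟩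
    funToFin (finToFun {m} {n} b)  ≡⟨ Finₚ.funToFin-finToFin {n} {m} b ⟩
    b                              ∎
    where
    fa≗fb : f (finToFun a) ≗ f (finToFun b)
    fa≗fb k = trans (sym (Finₚ.finToFun-funToFin _ k))
                    (trans (cong (λ c → finToFun c k) ha≡hb) (Finₚ.finToFun-funToFin _ k))

  preimage : ∃[ c ] h c ≡ funToFin t
  preimage = Fin-injective⇒surjective h h-injective (funToFin t)

  c : Fin (m ℕ.^ n)
  c = proj₁ preimage

  fc≗t : f (finToFun c) ≗ t
  fc≗t k = begin
    f (finToFun c) k         ≡⟨ Finₚ.finToFun-funToFin _ k ⟨
    finToFun (h c) k         ≡⟨ cong (λ c' → finToFun c' k) (proj₂ preimage) ⟩
    finToFun (funToFin t) k  ≡⟨ Finₚ.finToFun-funToFin t k ⟩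
    t k                      ∎

module _ {n} (L B : Mat n) (LB≋I : (L ⊗ B) ≋ I) where

  L·B·x≗x : ∀ x → L · (B · x) ≗ x
  L·B·x≗x x i = trans (·-assoc L B x i) (trans (·-congˡ LB≋I x i) (·-identityˡ x i))

  ·-surjective-mod : ∀ m .{{_ : ℕ.NonZero m}} (y : Vecℤ n) → ∃[ x ] (∀ i → (B · x) i ≡ y i mod m)
  ·-surjective-mod m y =
    let v , fv≗y = →-injective⇒surjective f f-injective (residue m ∘ y)
    in ι v , λ i → residue-≡⇒≡-mod m (fv≗y i)
    where
    open ≡-mod-Reasoning m
    ι : (Fin n → Fin m) → Vecℤ n
    ι v k = + toℕ (v k)

    f : (Fin n → Fin m) → Fin n → Fin m
    f v = residue m ∘ (B · ι v)

    f-injective : ∀ {v w} → f v ≗ f w → v ≗ w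
    f-injective {v} {w} fv≗fw k = toℕ-≡-mod⇒≡ (v k) (w k) (begin
      ι v k               ≡⟨ L·B·x≗x (ι v) k ⟨
      (L · (B · ι v)) k   ≈⟨ ·-cong-mod L (λ l → residue-≡⇒≡-mod m (fv≗fw l)) k ⟩
      (L · (B · ι w)) k   ≡⟨ L·B·x≗x (ι w) k ⟩
      ι w k               ∎)

  ⊗-inverseʳ-mod : ∀ m .{{_ : ℕ.NonZero m}} i j → (B ⊗ L) i j ≡ I i j mod m
  ⊗-inverseʳ-mod m i j = begin
    (B ⊗ L) i j  ≈⟨ ·-cong-mod B x≡Lⱼ i ⟨
    (B · x) i    ≈⟨ Bx≡eⱼ i ⟩
    I i j        ∎
    where
    open ≡-mod-Reasoning m
    x : Vecℤ n
    x = proj₁ (·-surjective-mod m (e j))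

    Bx≡eⱼ : ∀ k → (B · x) k ≡ e j k mod m
    Bx≡eⱼ = proj₂ (·-surjective-mod m (e j))

    x≡Lⱼ : ∀ k → x k ≡ L k j mod m
    x≡Lⱼ k = begin
      x k                ≡⟨ L·B·x≗x x k ⟨
      (L · (B · x)) k    ≈⟨ ·-cong-mod L Bx≡eⱼ k ⟩
      (L · e j) k        ≡⟨ ⊗-identityʳ L k j ⟩
      L k j              ∎

  leftInverse⇒rightInverse : (B ⊗ L) ≋ I
  leftInverse⇒rightInverse i j =
    ≡-mod⇒≡ (ℕₚ.n<1+n _) (⊗-inverseʳ-mod (ℕ.suc ∣ (B ⊗ L) i j - I i j ∣) i j)

-- Unit forms

module _ {n} (q q̃ : UnitForm n) (B Ǧq̃⁻¹ : Mat n) (inverse : IsInverse (Ǧ q̃) Ǧq̃⁻¹) where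

  private
    Ǧq̃⊗Ǧq̃⁻¹≋I : (Ǧ q̃ ⊗ Ǧq̃⁻¹) ≋ I
    Ǧq̃⊗Ǧq̃⁻¹≋I = proj₁ inverse

    Ǧq̃⁻¹⊗Ǧq̃≋I : (Ǧq̃⁻¹ ⊗ Ǧ q̃) ≋ I
    Ǧq̃⁻¹⊗Ǧq̃≋I = proj₂ inverse

    C : Mat n
    C = (B ᵀ) ⊗ (Ǧ q ⊗ B)

    B⋆ : Mat n
    B⋆ = Ǧq̃⁻¹ ⊗ ((B ᵀ) ⊗ Ǧ q)

  B⋆⊗B≋Ǧq̃⁻¹⊗C : (B⋆ ⊗ B) ≋ (Ǧq̃⁻¹ ⊗ C)
  B⋆⊗B≋Ǧq̃⁻¹⊗C i j = trans (⊗-assoc Ǧq̃⁻¹ ((B ᵀ) ⊗ Ǧ q) B i j) (⊗-congʳ Ǧq̃⁻¹ (⊗-assoc (B ᵀ) (Ǧ q) B) i j)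

  Ǧq̃⊗B⋆⊗B≋C : (Ǧ q̃ ⊗ (B⋆ ⊗ B)) ≋ C
  Ǧq̃⊗B⋆⊗B≋C = begin
    Ǧ q̃ ⊗ (B⋆ ⊗ B)        ≈⟨ ⊗-congʳ (Ǧ q̃) B⋆⊗B≋Ǧq̃⁻¹⊗C ⟩
    Ǧ q̃ ⊗ (Ǧq̃⁻¹ ⊗ C)     ≈⟨ ⊗-assoc (Ǧ q̃) Ǧq̃⁻¹ C ⟨
    (Ǧ q̃ ⊗ Ǧq̃⁻¹) ⊗ C     ≈⟨ ⊗-congˡ Ǧq̃⊗Ǧq̃⁻¹≋I C ⟩
    I ⊗ C                 ≈⟨ ⊗-identityˡ C ⟩
    C                     ∎
    where open ≋-Reasoning n

  eval∘B≡quadForm : ∀ x → eval q (B · x) ≡ quadForm C x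
  eval∘B≡quadForm x = trans (eval≡quadForm q (B · x)) (sym (quadForm-ᵀ⊗⊗ (Ǧ q) B x))

  congruent⇒isometry : Ǧ q̃ ≋ C → (∀ x → eval q̃ x ≡ eval q (B · x)) × (G q̃ ⊗ (B⋆ ⊗ B)) ≋ G q̃
  congruent⇒isometry Ǧq̃≋C = q̃≗q∘B , G⊗B⋆⊗B≋G
    where
    q̃≗q∘B : ∀ x → eval q̃ x ≡ eval q (B · x)
    q̃≗q∘B x = begin
      eval q̃ x           ≡⟨ eval≡quadForm q̃ x ⟩
      quadForm (Ǧ q̃) x   ≡⟨ dot-congʳ x (·-congˡ Ǧq̃≋C x) ⟩
      quadForm C x       ≡⟨ eval∘B≡quadForm x ⟨
      eval q (B · x)     ∎
      where open ≡-Reasoning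

    G⊗B⋆⊗B≋G : (G q̃ ⊗ (B⋆ ⊗ B)) ≋ G q̃
    G⊗B⋆⊗B≋G = begin
      G q̃ ⊗ (B⋆ ⊗ B)        ≈⟨ ⊗-congʳ (G q̃) B⋆⊗B≋Ǧq̃⁻¹⊗C ⟩
      G q̃ ⊗ (Ǧq̃⁻¹ ⊗ C)      ≈⟨ ⊗-congʳ (G q̃) (⊗-congʳ Ǧq̃⁻¹ Ǧq̃≋C) ⟨
      G q̃ ⊗ (Ǧq̃⁻¹ ⊗ Ǧ q̃)   ≈⟨ ⊗-congʳ (G q̃) Ǧq̃⁻¹⊗Ǧq̃≋I ⟩
      G q̃ ⊗ I               ≈⟨ ⊗-identityʳ (G q̃) ⟩
      G q̃                   ∎
      where open ≋-Reasoning n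

  congruent⇒invertible : Ǧ q̃ ≋ C → Invertible B
  congruent⇒invertible Ǧq̃≋C = B⋆ , leftInverse⇒rightInverse B⋆ B B⋆⊗B≋I , B⋆⊗B≋I
    where
    B⋆⊗B≋I : (B⋆ ⊗ B) ≋ I
    B⋆⊗B≋I = begin
      B⋆ ⊗ B          ≈⟨ B⋆⊗B≋Ǧq̃⁻¹⊗C ⟩
      Ǧq̃⁻¹ ⊗ C        ≈⟨ ⊗-congʳ Ǧq̃⁻¹ Ǧq̃≋C ⟨
      Ǧq̃⁻¹ ⊗ Ǧ q̃     ≈⟨ Ǧq̃⁻¹⊗Ǧq̃≋I ⟩
      I               ∎
      where open ≋-Reasoning n

  isometry⇒C⊖Ǧq̃-antisymmetric : (∀ x → eval q̃ x ≡ eval q (B · x)) →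
                                  ∀ i j → (C ⊖ Ǧ q̃) i j + (C ⊖ Ǧ q̃) j i ≡ 0ℤ
  isometry⇒C⊖Ǧq̃-antisymmetric q̃≗q∘B i j = begin
    (C i j - Ǧ q̃ i j) + (C j i - Ǧ q̃ j i)         ≡⟨ [a-b]+[c-d]≡[a+c]-[b+d] (C i j) _ _ _ ⟩
    (C i j + C j i) - (Ǧ q̃ i j + Ǧ q̃ j i)         ≡⟨ cong (_-_ (C i j + C j i)) symmetrisations-≡ ⟨
    (C i j + C j i) - (C i j + C j i)              ≡⟨ ℤₚ.+-inverseʳ (C i j + C j i) ⟩
    0ℤ                                             ∎
    where
    open ≡-Reasoning
    symmetrisations-≡ : C i j + C j i ≡ Ǧ q̃ i j + Ǧ q̃ j i
    symmetrisations-≡ = quadForm-≗⇒symmetrisation-≡ C (Ǧ q̃)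
      (λ x → trans (sym (eval∘B≡quadForm x)) (trans (sym (q̃≗q∘B x)) (eval≡quadForm q̃ x))) i j

  isometry⇒congruent : CorankAtMost1 q̃ → (∀ x → eval q̃ x ≡ eval q (B · x)) →
                       (G q̃ ⊗ (B⋆ ⊗ B)) ≋ G q̃ → Ǧ q̃ ≋ C
  isometry⇒congruent corank q̃≗q∘B G⊗B⋆⊗B≋G i j =
    sym (ℤₚ.i-j≡0⇒i≡j (C i j) (Ǧ q̃ i j)
      (trans (sym (D≋C⊖Ǧq̃ i j)) (antisymmetric∧dependentColumns⇒≋0 D D-antisymmetric D-dependent i j)))
    where
    K : Mat n
    K = (B⋆ ⊗ B) ⊖ I

    D : Mat n
    D = Ǧ q̃ ⊗ K

    K-inKer : ∀ j → InKer q̃ (col K j)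
    K-inKer j i = begin
      (G q̃ ⊗ K) i j                              ≡⟨ ⊗-distribˡ-⊖ (G q̃) (B⋆ ⊗ B) I i j ⟩
      (G q̃ ⊗ (B⋆ ⊗ B)) i j - (G q̃ ⊗ I) i j       ≡⟨ cong₂ _-_ (G⊗B⋆⊗B≋G i j) (⊗-identityʳ (G q̃) i j) ⟩
      G q̃ i j - G q̃ i j                          ≡⟨ ℤₚ.+-inverseʳ (G q̃ i j) ⟩
      0ℤ                                         ∎
      where open ≡-Reasoning

    D≋C⊖Ǧq̃ : D ≋ (C ⊖ Ǧ q̃)
    D≋C⊖Ǧq̃ i j = trans (⊗-distribˡ-⊖ (Ǧ q̃) (B⋆ ⊗ B) I i j)
                        (cong₂ _-_ (Ǧq̃⊗B⋆⊗B≋C i j) (⊗-identityʳ (Ǧ q̃) i j))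

    D-antisymmetric : ∀ i j → D i j + D j i ≡ 0ℤ
    D-antisymmetric i j =
      trans (cong₂ _+_ (D≋C⊖Ǧq̃ i j) (D≋C⊖Ǧq̃ j i)) (isometry⇒C⊖Ǧq̃-antisymmetric q̃≗q∘B i j)

    D-dependent : ∀ i j → LinearlyDependent (col D i) (col D j)
    D-dependent i j = ·-preserves-LinearlyDependent (Ǧ q̃) (corank (col K i) (col K j) (K-inKer i) (K-inKer j))

lemma4p12 : ∀ (n : ℕ) (q q̃ : UnitForm n) →
    NonNegative q → Connected q → NonNegative q̃ → Connected q̃ → CorankAtMost1 q̃ →
    (B : Mat n) →
    -- Ǧ_q̃⁻¹ (unique two-sided inverse of the unitriangular matrix Ǧ_q̃)
    (Ǧq̃⁻¹ : Mat n) → IsInverse (Ǧ q̃) Ǧq̃⁻¹ →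
    (Invertible B × Ǧ q̃ ≋ ((B ᵀ) ⊗ (Ǧ q ⊗ B)))
    ⇔
    ((∀ x → eval q̃ x ≡ eval q (B · x)) ×
     (G q̃ ⊗ ((Ǧq̃⁻¹ ⊗ ((B ᵀ) ⊗ Ǧ q)) ⊗ B)) ≋ G q̃)
lemma4p12 n q q̃ _ _ _ _ corank B Ǧq̃⁻¹ inverse = mk⇔
  (λ (_ , Ǧq̃≋C) → congruent⇒isometry q q̃ B Ǧq̃⁻¹ inverse Ǧq̃≋C)
  (λ (q̃≗q∘B , G⊗B⋆⊗B≋G) →
    let Ǧq̃≋C = isometry⇒congruent q q̃ B Ǧq̃⁻¹ inverse corank q̃≗q∘B G⊗B⋆⊗B≋G
    in congruent⇒invertible q q̃ B Ǧq̃⁻¹ inverse Ǧq̃≋C , Ǧq̃≋C)
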